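{- Let $p$ be an odd prime with $p \equiv 2 \pmod 3$, and let $c$ be an integer with $2 \le c \le p-2$. For a positive integer $n$, let $M_n = [m_{ij}]_{1 \le i,j \le n}$ be the $n \times n$ matrix with entries $m_{ij} = \left[ \frac{j-i+c}{p} \right]$. Then for every $n$ with $2 \le n \le p-2$, $\det(M_n) = 0$.
   Context: For an odd prime $p$ and an integer $a$, the cubic residue symbol is defined by $\left[ \frac{a}{p} \right] = 1$ if $a \not\equiv 0 \pmod p$ and $x^3 \equiv a \pmod p$ has an integer solution; $\left[ \frac{a}{p} \right] = -1$ if $x^3 \equiv a \pmod p$ has no integer solution; and $\left[ \frac{a}{p} \right] = 0$ if $a \equiv 0 \pmod p$. -}

module Defs where

open import Data.Nat as ℕ using (ℕ; zero; suc; NonZero)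
open import Data.Nat.Properties as ℕP using ()
open import Data.Integer as ℤ using (ℤ; +_; _-_; _*_; _+_; -_; _%ℕ_)
open import Data.Fin using (Fin; zero; suc; punchIn; toℕ)
open import Data.List using (upTo)
open import Data.List.Relation.Unary.Any using (any?)
open import Relation.Nullary using (yes; no)

cube : ℤ → ℤ
cube x = x * x * x

-- An integer solution exists iff one exists among the residues x = 0, …, p-1,
-- which is how the (decidable) existence test is carried out.
cubicSym : (p : ℕ) .{{_ : NonZero p}} → ℤ → ℤ
cubicSym p a with a %ℕ p ℕ.≟ 0
... | yes _ = + 0
... | no _ with any? (λ x → ((cube (+ x) - a) %ℕ p) ℕ.≟ 0) (upTo p)
...   | yes _ = + 1
...   | no _ = - (+ 1)

Matrix : ℕ → Set
Matrix n = Fin n → Fin n → ℤ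

sumFin : (n : ℕ) → (Fin n → ℤ) → ℤ
sumFin zero f = + 0
sumFin (suc n) f = f zero + sumFin n (λ i → f (suc i))

sign : ℕ → ℤ
sign zero = + 1
sign (suc k) = - sign k

det : (n : ℕ) → Matrix n → ℤ
det zero M = + 1
det (suc n) M =
  sumFin (suc n) (λ j → sign (toℕ j) * M zero j * det n (λ i k → M (suc i) (punchIn j k)))

-- M_n = [ [ (j - i + c) / p ] ]_{1 ≤ i,j ≤ n}; with 0-based indices j - i is unchanged.
cubicMatrix : (p : ℕ) .{{_ : NonZero p}} → (c : ℤ) → (n : ℕ) → Matrix n
cubicMatrix p c n i j = cubicSym p ((+ toℕ j) - (+ toℕ i) + c)

module Submission where

-- Since p ≡ 2 (mod 3), every residue is a cube: writing p = 3q + 2, Fermat's little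
-- theorem gives (m ^ (2q + 1)) ^ 3 = m ^ p * m ^ (p - 1) ≡ m * m ^ (p - 1) = m ^ p ≡ m
-- (mod p). Hence [a/p] = 1 whenever 0 < a < p. In row i of M_n the arguments
-- j - i + c (0 ≤ j < n) lie strictly between 0 and p as soon as i < c and
-- n + c ≤ i + p, and for r = n + c ∸ p both rows r and r + 1 are of this kind.
-- So M_n has two equal adjacent rows of ones, and its determinant vanishes.

open import Defs

module Determinant where

  open import Data.Nat as ℕ using (ℕ; zero; suc)
  import Data.Nat.Properties as ℕP
  open import Data.Integer using (ℤ; +_; _+_; _-_; _*_; -_)
  import Data.Integer.Properties as ℤP
  open import Data.Integer.Tactic.RingSolver using (solve-∀)
  open import Data.Fin using (Fin; zero; suc; toℕ; punchIn; inject₁; _≤_)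
  open import Data.Fin.Properties using (_≤?_; toℕ-inject₁)
  open import Function using (_∘_)
  open import Relation.Nullary using (yes; no; contradiction)
  open import Relation.Binary.PropositionalEquality
  open import Algebra.Properties.CommutativeMonoid.Sum ℤP.+-0-commutativeMonoid
    using (sum; sum-syntax; sum-cong-≗; sum-remove; sum-replicate-zero; ∑-comm)
  open import Algebra.Properties.Semiring.Sum ℤP.+-*-semiring using (*-distribˡ-sum)

  sumFin≡sum : ∀ n (f : Fin n → ℤ) → sumFin n f ≡ sum f
  sumFin≡sum zero f = refl
  sumFin≡sum (suc n) f = cong (_+_ (f zero)) (sumFin≡sum n (f ∘ suc))

  sum-neg : ∀ {m} (f : Fin m → ℤ) → sum (λ i → - f i) ≡ - sum f
  sum-neg {zero} f = refl
  sum-neg {suc m} f =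
    trans (cong (_+_ (- f zero)) (sum-neg (f ∘ suc))) (sym (ℤP.neg-distrib-+ (f zero) _))

  x≡-x⇒x≡0 : ∀ {x} → x ≡ - x → x ≡ + 0
  x≡-x⇒x≡0 {+ zero} _ = refl

  -- A double sum of an antisymmetric family vanishes: it equals its own negative.
  ∑∑-antisym : ∀ {m} (V : Fin m → Fin m → ℤ) → (∀ j l → V l j ≡ - V j l) →
    ∑[ j < m ] (∑[ l < m ] V j l) ≡ + 0
  ∑∑-antisym {m} V anti = x≡-x⇒x≡0 (begin
    ∑[ j < m ] (∑[ l < m ] V j l)   ≡⟨ ∑-comm V ⟩
    ∑[ l < m ] (∑[ j < m ] V j l)   ≡⟨ sum-cong-≗ (λ l → sum-cong-≗ (λ j → anti l j)) ⟩
    ∑[ l < m ] (∑[ j < m ] (- V l j)) ≡⟨ sum-cong-≗ (λ l → sum-neg (V l)) ⟩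
    ∑[ l < m ] (- ∑[ j < m ] V l j) ≡⟨ sum-neg (λ l → sum (V l)) ⟩
    - ∑[ l < m ] (∑[ j < m ] V l j) ∎)
    where open ≡-Reasoning

  sum-punchIn : ∀ {m} (f : Fin (suc m) → ℤ) (j : Fin (suc m)) → f j ≡ + 0 →
    sum f ≡ sum (f ∘ punchIn j)
  sum-punchIn f j fj≡0 =
    trans (sum-remove {i = j} f) (trans (cong (_+ sum (f ∘ punchIn j)) fj≡0) (ℤP.+-identityˡ _))

  punchIn-≥ : ∀ {m} (j : Fin (suc m)) (k : Fin m) → j ≤ k → punchIn j k ≡ suc k
  punchIn-≥ zero k _ = refl
  punchIn-≥ (suc j) (suc k) (ℕ.s≤s j≤k) = cong suc (punchIn-≥ j k j≤k)

  punchIn-< : ∀ {m} (j k : Fin m) → k ≤ j → punchIn (suc j) k ≡ inject₁ k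
  punchIn-< j zero _ = refl
  punchIn-< (suc j) (suc k) (ℕ.s≤s k≤j) = cong suc (punchIn-< j k k≤j)

  -- Deleting columns j+1 and k (k ≤ j) in either order leaves the same columns.
  punchIn-punchIn : ∀ {m} (k j : Fin (suc m)) (l : Fin m) → k ≤ j →
    punchIn (suc j) (punchIn k l) ≡ punchIn (inject₁ k) (punchIn j l)
  punchIn-punchIn zero j l _ = refl
  punchIn-punchIn (suc k) (suc j) zero (ℕ.s≤s k≤j) = refl
  punchIn-punchIn (suc k) (suc j) (suc l) (ℕ.s≤s k≤j) = cong suc (punchIn-punchIn k j l k≤j)

  minor : ∀ {n} → Matrix (suc n) → Fin (suc n) → Matrix n
  minor M j i k = M (suc i) (punchIn j k)

  σ : ∀ {n} → Fin n → ℤ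
  σ j = sign (toℕ j)

  det-expand : ∀ n (M : Matrix (suc n)) →
    det (suc n) M ≡ ∑[ j < suc n ] (σ j * M zero j * det n (minor M j))
  det-expand n M = sumFin≡sum (suc n) (λ j → σ j * M zero j * det n (minor M j))

  det-cong : ∀ n {M N : Matrix n} → (∀ i j → M i j ≡ N i j) → det n M ≡ det n N
  det-cong zero M≗N = refl
  det-cong (suc n) {M} {N} M≗N = begin
    det (suc n) M ≡⟨ det-expand n M ⟩
    ∑[ j < suc n ] (σ j * M zero j * det n (minor M j))
      ≡⟨ sum-cong-≗ (λ j → cong₂ (λ x d → σ j * x * d) (M≗N zero j)
                             (det-cong n (λ i k → M≗N (suc i) (punchIn j k)))) ⟩
    ∑[ j < suc n ] (σ j * N zero j * det n (minor N j)) ≡⟨ sym (det-expand n N) ⟩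
    det (suc n) N ∎
    where open ≡-Reasoning

  -- Expanding det M twice along the first row writes it as a sum over ordered pairs of
  -- distinct columns (j, punchIn j k). When rows 0 and 1 coincide, the terms of the
  -- pairs (j, l) and (l, j) cancel, so det M = 0.
  module EqualFirstRows {n : ℕ} (M : Matrix (suc (suc n))) where

    a : Fin (suc (suc n)) → ℤ
    a = M zero

    D : Fin (suc (suc n)) → Fin (suc n) → ℤ
    D j k = det n (minor (minor M j) k)

    T : Fin (suc (suc n)) → Fin (suc n) → ℤ
    T j k = σ j * a j * (σ k * a (punchIn j k) * D j k)

    -- Swapping the roles of the two columns changes the sign of the term:
    -- the same columns are deleted, but one sign factor moves by one place.
    T-swap : ∀ j k → k ≤ j → T (suc j) k ≡ - T (inject₁ k) j
    T-swap j k k≤j = begin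
      T (suc j) k
        ≡⟨ cong₂ (λ c d → - σ j * a (suc j) * (σ k * a c * d)) (punchIn-< j k k≤j) D-swap ⟩
      - σ j * a (suc j) * (σ k * a (inject₁ k) * D (inject₁ k) j)
        ≡⟨ reorder (σ j) (a (suc j)) (σ k) (a (inject₁ k)) (D (inject₁ k) j) ⟩
      - (σ k * a (inject₁ k) * (σ j * a (suc j) * D (inject₁ k) j))
        ≡⟨ cong₂ (λ s c → - (s * a (inject₁ k) * (σ j * a c * D (inject₁ k) j)))
                 (cong sign (sym (toℕ-inject₁ k))) (sym (punchIn-≥ (inject₁ k) j k′≤j)) ⟩
      - T (inject₁ k) j ∎
      where
      open ≡-Reasoning
      k′≤j : inject₁ k ≤ j
      k′≤j = subst (ℕ._≤ toℕ j) (sym (toℕ-inject₁ k)) k≤j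
      D-swap : D (suc j) k ≡ D (inject₁ k) j
      D-swap = det-cong n (λ i l → cong (M (suc (suc i))) (punchIn-punchIn k j l k≤j))
      reorder : ∀ s x t y d → - s * x * (t * y * d) ≡ - (t * y * (s * x * d))
      reorder = solve-∀

    -- U j l is the term of the ordered pair of columns j < l, and 0 otherwise.
    U : Fin (suc (suc n)) → Fin (suc (suc n)) → ℤ
    U j zero = + 0
    U j (suc k) with j ≤? k
    ... | yes _ = T j k
    ... | no _ = + 0

    U-< : ∀ j k → j ≤ k → U j (suc k) ≡ T j k
    U-< j k j≤k with j ≤? k
    ... | yes _ = refl
    ... | no j≰k = contradiction j≤k j≰k

    U-≥ : ∀ j l → l ≤ j → U j l ≡ + 0
    U-≥ j zero _ = refl
    U-≥ j (suc k) k<j with j ≤? k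
    ... | yes j≤k = contradiction j≤k (ℕP.<⇒≱ k<j)
    ... | no _ = refl

    V : Fin (suc (suc n)) → Fin (suc (suc n)) → ℤ
    V j l = U j l - U l j

    V-antisym : ∀ j l → V l j ≡ - V j l
    V-antisym j l = flip-difference (U j l) (U l j)
      where
      flip-difference : ∀ x y → y - x ≡ - (x - y)
      flip-difference = solve-∀

    V-diag : ∀ j → V j j ≡ + 0
    V-diag j = ℤP.+-inverseʳ (U j j)

    T≡V : ∀ j k → T j k ≡ V j (punchIn j k)
    T≡V j k with j ≤? k
    ... | yes j≤k = begin
      T j k                         ≡⟨ sym (ℤP.+-identityʳ (T j k)) ⟩
      T j k - + 0                   ≡⟨ cong₂ _-_ (sym (U-< j k j≤k))
                                                  (sym (U-≥ (suc k) j (ℕP.m≤n⇒m≤1+n j≤k))) ⟩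
      V j (suc k)                   ≡⟨ cong (V j) (sym (punchIn-≥ j k j≤k)) ⟩
      V j (punchIn j k)             ∎
      where open ≡-Reasoning
    T≡V zero k | no 0≰k = contradiction ℕ.z≤n 0≰k
    T≡V (suc j) k | no 1+j≰k = begin
      T (suc j) k                   ≡⟨ T-swap j k k≤j ⟩
      - T (inject₁ k) j             ≡⟨ sym (ℤP.+-identityˡ (- T (inject₁ k) j)) ⟩
      + 0 - T (inject₁ k) j         ≡⟨ cong₂ _-_ (sym (U-≥ (suc j) (inject₁ k) k′≤1+j))
                                                  (sym (U-< (inject₁ k) j k′≤j)) ⟩
      V (suc j) (inject₁ k)         ≡⟨ cong (V (suc j)) (sym (punchIn-< j k k≤j)) ⟩
      V (suc j) (punchIn (suc j) k) ∎
      where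
      open ≡-Reasoning
      k≤j : k ≤ j
      k≤j = ℕP.≤-pred (ℕP.≰⇒> 1+j≰k)
      k′≤j : inject₁ k ≤ j
      k′≤j = subst (ℕ._≤ toℕ j) (sym (toℕ-inject₁ k)) k≤j
      k′≤1+j : inject₁ k ≤ suc j
      k′≤1+j = ℕP.m≤n⇒m≤1+n k′≤j

    det≡∑∑T : (∀ x → M (suc zero) x ≡ a x) →
      det (suc (suc n)) M ≡ ∑[ j < suc (suc n) ] (∑[ k < suc n ] T j k)
    det≡∑∑T row₁≡row₀ = trans (det-expand (suc n) M) (sum-cong-≗ λ j → begin
      σ j * a j * det (suc n) (minor M j)
        ≡⟨ cong (σ j * a j *_) (det-expand n (minor M j)) ⟩
      σ j * a j * ∑[ k < suc n ] (σ k * M (suc zero) (punchIn j k) * D j k)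
        ≡⟨ *-distribˡ-sum (σ j * a j) (λ k → σ k * M (suc zero) (punchIn j k) * D j k) ⟩
      ∑[ k < suc n ] (σ j * a j * (σ k * M (suc zero) (punchIn j k) * D j k))
        ≡⟨ sum-cong-≗ (λ k → cong (λ x → σ j * a j * (σ k * x * D j k))
                                  (row₁≡row₀ (punchIn j k))) ⟩
      ∑[ k < suc n ] T j k ∎)
      where open ≡-Reasoning

    det≡0 : (∀ x → M (suc zero) x ≡ a x) → det (suc (suc n)) M ≡ + 0
    det≡0 row₁≡row₀ = begin
      det (suc (suc n)) M
        ≡⟨ det≡∑∑T row₁≡row₀ ⟩
      ∑[ j < suc (suc n) ] (∑[ k < suc n ] T j k)
        ≡⟨ sum-cong-≗ (λ j → sum-cong-≗ (T≡V j)) ⟩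
      ∑[ j < suc (suc n) ] (∑[ k < suc n ] V j (punchIn j k))
        ≡⟨ sum-cong-≗ (λ j → sym (sum-punchIn (V j) j (V-diag j))) ⟩
      ∑[ j < suc (suc n) ] (∑[ l < suc (suc n) ] V j l)
        ≡⟨ ∑∑-antisym V V-antisym ⟩
      + 0 ∎
      where open ≡-Reasoning

  -- A matrix with two equal adjacent rows has determinant 0: expanding along the first
  -- row moves the pair of rows up, until it is the pair of the first two rows.
  det-adjacent-rows : ∀ n (M : Matrix (suc (suc n))) (i : Fin (suc n)) →
    (∀ x → M (suc i) x ≡ M (inject₁ i) x) → det (suc (suc n)) M ≡ + 0
  det-adjacent-rows n M zero rows≡ = EqualFirstRows.det≡0 M rows≡
  det-adjacent-rows (suc n) M (suc i) rows≡ = begin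
    det (suc (suc (suc n))) M ≡⟨ det-expand (suc (suc n)) M ⟩
    ∑[ j < suc (suc (suc n)) ] (σ j * M zero j * det (suc (suc n)) (minor M j))
      ≡⟨ sum-cong-≗ (λ j → trans (cong (σ j * M zero j *_) (minor≡0 j))
                                 (ℤP.*-zeroʳ (σ j * M zero j))) ⟩
    ∑[ j < suc (suc (suc n)) ] (+ 0) ≡⟨ sum-replicate-zero (suc (suc (suc n))) ⟩
    + 0 ∎
    where
    open ≡-Reasoning
    minor≡0 : ∀ j → det (suc (suc n)) (minor M j) ≡ + 0
    minor≡0 j = det-adjacent-rows n (minor M j) i (λ x → rows≡ (punchIn j x))

module Residues where

  open import Data.Nat
  open import Data.Nat.Properties
  open import Data.Nat.DivMod
  open import Data.Nat.Divisibility
  open import Data.Nat.Combinatorics using (_C_; nCk≡n!/k![n-k]!; nCn≡1; k![n∸k]!∣n!)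
  open import Data.Nat.Primality using (Prime; euclidsLemma; prime⇒nonZero; prime⇒nonTrivial)
  open import Data.Nat.Tactic.RingSolver using (solve-∀)
  open import Data.Fin using (Fin; zero; suc; toℕ; inject₁; fromℕ)
  open import Data.Fin.Properties using (toℕ-inject₁; toℕ<n; toℕ-fromℕ)
  open import Data.Product using (∃-syntax; _×_; _,_)
  open import Data.Sum using (inj₁; inj₂)
  open import Function using (_∘_)
  open import Relation.Nullary using (¬_; contradiction)
  open import Relation.Binary.PropositionalEquality
  open import Algebra.Properties.Monoid.Sum +-0-monoid
    using (sum; sum⁺-syntax; sum-cong-≗; sum-init-last)
  open import Algebra.Properties.CommutativeSemigroup +-commutativeSemigroup using (x∙yz≈y∙xz)
  import Algebra.Properties.CommutativeSemiring.Binomial +-*-commutativeSemiring as Binomial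
  import Algebra.Definitions.RawSemiring +-*-rawSemiring as S

  ∣-sum : ∀ {d n} (t : Fin n → ℕ) → (∀ k → d ∣ t k) → d ∣ sum t
  ∣-sum {n = zero} t d∣t = _ ∣0
  ∣-sum {n = suc n} t d∣t = ∣m∣n⇒∣m+n (d∣t zero) (∣-sum (t ∘ suc) (d∣t ∘ suc))

  sum-mod-ends : ∀ {d} .{{_ : NonZero d}} n → 0 < n → (t : Fin (suc n) → ℕ) →
    (∀ k → 0 < toℕ k → toℕ k < n → d ∣ t k) → sum t % d ≡ (t zero + t (fromℕ n)) % d
  sum-mod-ends {d} (suc m) _ t interior = begin
    (t zero + sum (t ∘ suc)) % d
      ≡⟨ cong (λ s → (t zero + s) % d) (sum-init-last (t ∘ suc)) ⟩
    (t zero + (I + t (fromℕ (suc m)))) % d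
      ≡⟨ cong (_% d) (x∙yz≈y∙xz (t zero) I _) ⟩
    (I + (t zero + t (fromℕ (suc m)))) % d
      ≡⟨ %-remove-+ˡ _ (∣-sum (t ∘ suc ∘ inject₁) d∣interior) ⟩
    (t zero + t (fromℕ (suc m))) % d ∎
    where
    open ≡-Reasoning
    I = sum (t ∘ suc ∘ inject₁)
    d∣interior : ∀ k → d ∣ t (suc (inject₁ k))
    d∣interior k =
      interior (suc (inject₁ k)) z<s (s≤s (subst (_< m) (sym (toℕ-inject₁ k)) (toℕ<n k)))

  binomial : ∀ n x → (x + 1) ^ n ≡ ∑[ k ≤ n ] ((n C toℕ k) * x ^ toℕ k)
  binomial n x = begin
    (x + 1) ^ n                                               ≡⟨ sym (^≡^ (x + 1) n) ⟩
    (x + 1) S.^ n                                             ≡⟨ Binomial.theorem n x 1 ⟩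
    ∑[ k ≤ n ] ((n C toℕ k) S.× (x S.^ toℕ k * 1 S.^ (n ∸ toℕ k))) ≡⟨ sum-cong-≗ {suc n} term ⟩
    ∑[ k ≤ n ] ((n C toℕ k) * x ^ toℕ k)                      ∎
    where
    open ≡-Reasoning
    ^≡^ : ∀ y m → y S.^ m ≡ y ^ m
    ^≡^ y zero = refl
    ^≡^ y (suc m) = cong (y *_) (^≡^ y m)
    ×≡* : ∀ m y → m S.× y ≡ m * y
    ×≡* zero y = refl
    ×≡* (suc m) y = cong (y +_) (×≡* m y)
    term : ∀ k → (n C toℕ k) S.× (x S.^ toℕ k * 1 S.^ (n ∸ toℕ k)) ≡ (n C toℕ k) * x ^ toℕ k
    term k = begin
      (n C toℕ k) S.× (x S.^ toℕ k * 1 S.^ (n ∸ toℕ k)) ≡⟨ ×≡* (n C toℕ k) _ ⟩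
      (n C toℕ k) * (x S.^ toℕ k * 1 S.^ (n ∸ toℕ k))
        ≡⟨ cong₂ (λ u v → (n C toℕ k) * (u * v)) (^≡^ x (toℕ k))
                 (trans (^≡^ 1 (n ∸ toℕ k)) (^-zeroˡ (n ∸ toℕ k))) ⟩
      (n C toℕ k) * (x ^ toℕ k * 1)                     ≡⟨ cong ((n C toℕ k) *_) (*-identityʳ (x ^ toℕ k)) ⟩
      (n C toℕ k) * x ^ toℕ k                           ∎

  n∣n! : ∀ n .{{_ : NonZero n}} → n ∣ n !
  n∣n! (suc n) = m∣m*n (n !)

  C*k!*[n∸k]!≡n! : ∀ {n k} → k ≤ n → (n C k) * (k ! * (n ∸ k) !) ≡ n !
  C*k!*[n∸k]!≡n! {n} {k} k≤n =
    trans (cong (_* (k ! * (n ∸ k) !)) (nCk≡n!/k![n-k]! k≤n)) (m/n*n≡m (k![n∸k]!∣n! k≤n))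
    where instance _ = k !* (n ∸ k) !≢0

  module _ {p : ℕ} (pr : Prime p) where

    instance
      p≢0 : NonZero p
      p≢0 = prime⇒nonZero pr

    ∤-below : ∀ {m} → 0 < m → m < p → ¬ p ∣ m
    ∤-below 0<m m<p p∣m = <⇒≱ m<p (∣⇒≤ {{>-nonZero 0<m}} p∣m)

    ∤-! : ∀ {k} → k < p → ¬ p ∣ k !
    ∤-! {zero} _ p∣1 = nonTrivial⇒≢1 {{prime⇒nonTrivial pr}} (∣1⇒≡1 p∣1)
    ∤-! {suc k} k<p p∣k! with euclidsLemma (suc k) (k !) pr p∣k!
    ... | inj₁ p∣1+k = ∤-below z<s k<p p∣1+k
    ... | inj₂ p∣k!′ = ∤-! (<-trans (n<1+n k) k<p) p∣k!′

    -- p divides p C k for 0 < k < p: it divides p! = (p C k) * k! * (p - k)!, but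
    -- neither k! nor (p - k)!.
    ∣-C : ∀ {k} → 0 < k → k < p → p ∣ p C k
    ∣-C {k} 0<k k<p with euclidsLemma (p C k) (k ! * (p ∸ k) !) pr p∣C*k!*[p∸k]!
      where
      p∣C*k!*[p∸k]! : p ∣ (p C k) * (k ! * (p ∸ k) !)
      p∣C*k!*[p∸k]! = subst (p ∣_) (sym (C*k!*[n∸k]!≡n! (<⇒≤ k<p))) (n∣n! p)
    ... | inj₁ p∣C = p∣C
    ... | inj₂ p∣k!*[p-k]! with euclidsLemma (k !) ((p ∸ k) !) pr p∣k!*[p-k]!
    ...   | inj₁ p∣k! = contradiction p∣k! (∤-! k<p)
    ...   | inj₂ p∣[p-k]! = contradiction p∣[p-k]! (∤-! (∸-monoʳ-< 0<k (<⇒≤ k<p)))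

    -- (x + 1) ^ p ≡ x ^ p + 1 (mod p): all interior binomial terms are multiples of p.
    freshman : ∀ x → (x + 1) ^ p % p ≡ (1 + x ^ p) % p
    freshman x = begin
      (x + 1) ^ p % p               ≡⟨ cong (_% p) (binomial p x) ⟩
      (∑[ k ≤ p ] t k) % p          ≡⟨ sum-mod-ends p (>-nonZero⁻¹ p) t interior ⟩
      (t zero + t (fromℕ p)) % p    ≡⟨ cong (λ e → (1 + e) % p) last ⟩
      (1 + x ^ p) % p               ∎
      where
      open ≡-Reasoning
      t : Fin (suc p) → ℕ
      t k = (p C toℕ k) * x ^ toℕ k
      interior : ∀ k → 0 < toℕ k → toℕ k < p → p ∣ t k
      interior k 0<k k<p = ∣m⇒∣m*n (x ^ toℕ k) (∣-C 0<k k<p)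
      last : t (fromℕ p) ≡ x ^ p
      last rewrite toℕ-fromℕ p | nCn≡1 p = +-identityʳ (x ^ p)

    fermat : ∀ x → x ^ p % p ≡ x % p
    fermat zero = cong (_% p) (0^n≡0 p)
      where
      0^n≡0 : ∀ n .{{_ : NonZero n}} → 0 ^ n ≡ 0
      0^n≡0 (suc n) = refl
    fermat (suc x) = begin
      suc x ^ p % p             ≡⟨ cong (λ y → y ^ p % p) (+-comm 1 x) ⟩
      (x + 1) ^ p % p           ≡⟨ freshman x ⟩
      (1 + x ^ p) % p           ≡⟨ %-distribˡ-+ 1 (x ^ p) p ⟩
      (1 % p + x ^ p % p) % p   ≡⟨ cong (λ r → (1 % p + r) % p) (fermat x) ⟩
      (1 % p + x % p) % p       ≡⟨ sym (%-distribˡ-+ 1 x p) ⟩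
      suc x % p                 ∎
      where open ≡-Reasoning

    *-cong-% : ∀ {a a′ b b′} → a % p ≡ a′ % p → b % p ≡ b′ % p → (a * b) % p ≡ (a′ * b′) % p
    *-cong-% {a} {a′} {b} {b′} a≡a′ b≡b′ = begin
      (a * b) % p               ≡⟨ %-distribˡ-* a b p ⟩
      (a % p * (b % p)) % p     ≡⟨ cong₂ (λ r s → (r * s) % p) a≡a′ b≡b′ ⟩
      (a′ % p * (b′ % p)) % p   ≡⟨ sym (%-distribˡ-* a′ b′ p) ⟩
      (a′ * b′) % p             ∎
      where open ≡-Reasoning

    ^-% : ∀ y n → (y % p) ^ n % p ≡ y ^ n % p
    ^-% y zero = refl
    ^-% y (suc n) = *-cong-% (m%n%n≡m%n y p) (^-% y n)

    -- When p = 3q + 2, every m is a cube modulo p, namely of m ^ (2q + 1), reduced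
    -- below p: its cube is m ^ (p + (p - 1)) = m ^ p * m ^ (p - 1) ≡ m * m ^ (p - 1) ≡ m.
    cube-root : p % 3 ≡ 2 → ∀ m → ∃[ x ] x < p × x ^ 3 % p ≡ m % p
    cube-root p%3≡2 m = y % p , m%n<n y p , (begin
      (y % p) ^ 3 % p             ≡⟨ ^-% y 3 ⟩
      y ^ 3 % p                   ≡⟨ cong (_% p) (^-*-assoc m e 3) ⟩
      m ^ (e * 3) % p             ≡⟨ cong (λ k → m ^ k % p) exponent ⟩
      m ^ (p + pred p) % p        ≡⟨ cong (_% p) (^-distribˡ-+-* m p (pred p)) ⟩
      (m ^ p * m ^ pred p) % p    ≡⟨ *-cong-% (fermat m) refl ⟩
      m ^ suc (pred p) % p        ≡⟨ cong (λ k → m ^ k % p) (suc-pred p) ⟩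
      m ^ p % p                   ≡⟨ fermat m ⟩
      m % p                       ∎)
      where
      open ≡-Reasoning
      q = p / 3
      e = 1 + 2 * q
      y = m ^ e
      p≡3q+2 : p ≡ 2 + q * 3
      p≡3q+2 = trans (m≡m%n+[m/n]*n p 3) (cong (_+ q * 3) p%3≡2)
      arith : ∀ q → (1 + 2 * q) * 3 ≡ (2 + q * 3) + (1 + q * 3)
      arith = solve-∀
      exponent : e * 3 ≡ p + pred p
      exponent = trans (arith q) (cong (λ r → r + pred r) (sym p≡3q+2))

module CubicSymbol where

  open import Data.Nat using (ℕ; suc; NonZero; _+_; _*_; _∸_; _^_; _/_; _%_; _<_; _≤_; s≤s; _≟_)
  open import Data.Nat.Properties
  open import Data.Nat.DivMod using (m≡m%n+[m/n]*n; m<n⇒m%n≡m; m*n%n≡0)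
  open import Data.Nat.Primality using (Prime; prime⇒nonZero)
  open import Data.Nat.Tactic.RingSolver using (solve-∀)
  open import Data.Integer as ℤ using (ℤ; +_; _-_; _%ℕ_)
  import Data.Integer.Properties as ℤP
  import Data.Integer.Tactic.RingSolver as ℤ-Solver
  open import Data.Fin using (Fin; suc; toℕ; inject₁; fromℕ<)
  open import Data.Fin.Properties using (toℕ<n; toℕ-inject₁; toℕ-fromℕ<)
  open import Data.List using (upTo)
  open import Data.List.Relation.Unary.Any using (any?)
  open import Data.List.Membership.Propositional using (lose)
  open import Data.List.Membership.Propositional.Properties using (∈-upTo⁺)
  open import Data.Product using (∃-syntax; _,_)
  open import Relation.Nullary using (yes; no; ¬_; contradiction)
  open import Relation.Binary.PropositionalEquality
  open Residues using (cube-root)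

  cubicSym-cube : (p : ℕ) .{{_ : NonZero p}} (a : ℤ) → ¬ a %ℕ p ≡ 0 → ∀ x → x < p →
    (cube (+ x) - a) %ℕ p ≡ 0 → cubicSym p a ≡ + 1
  cubicSym-cube p a a≢0 x x<p root with a %ℕ p ≟ 0
  ... | yes a≡0 = contradiction a≡0 a≢0
  ... | no _ with any? (λ y → ((cube (+ y) - a) %ℕ p) ≟ 0) (upTo p)
  ...   | yes _ = refl
  ...   | no no-root = contradiction (lose (∈-upTo⁺ x<p) root) no-root

  cube-+ : ∀ x → cube (+ x) ≡ + (x ^ 3)
  cube-+ x = begin
    + x ℤ.* + x ℤ.* + x   ≡⟨ cong (ℤ._* + x) (sym (ℤP.pos-* x x)) ⟩
    + (x * x) ℤ.* + x     ≡⟨ sym (ℤP.pos-* (x * x) x) ⟩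
    + (x * x * x)         ≡⟨ cong +_ (*-assoc x x x) ⟩
    + (x * (x * x))       ≡⟨ cong (λ z → + (x * (x * z))) (sym (*-identityʳ x)) ⟩
    + (x ^ 3)             ∎
    where open ≡-Reasoning

  +[m+n]-+m : ∀ m n → + (m + n) - + m ≡ + n
  +[m+n]-+m m n = begin
    + (m + n) - + m   ≡⟨ ℤP.[+m]-[+n]≡m⊖n (m + n) m ⟩
    (m + n) ℤ.⊖ m     ≡⟨ ℤP.⊖-≥ (m≤m+n m n) ⟩
    + (m + n ∸ m)     ≡⟨ cong +_ (m+n∸m≡n m n) ⟩
    + n               ∎
    where open ≡-Reasoning

  shift : ∀ i j c → i ≤ j + c → + j - + i ℤ.+ + c ≡ + (j + c ∸ i)
  shift i j c i≤j+c = begin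
    + j - + i ℤ.+ + c        ≡⟨ reorder (+ j) (+ i) (+ c) ⟩
    (+ j ℤ.+ + c) - + i      ≡⟨ cong (_- + i) (sym (ℤP.pos-+ j c)) ⟩
    + (j + c) - + i          ≡⟨ ℤP.[+m]-[+n]≡m⊖n (j + c) i ⟩
    (j + c) ℤ.⊖ i            ≡⟨ ℤP.⊖-≥ i≤j+c ⟩
    + (j + c ∸ i)            ∎
    where
    open ≡-Reasoning
    reorder : ∀ a b d → a - b ℤ.+ d ≡ (a ℤ.+ d) - b
    reorder = ℤ-Solver.solve-∀

  cube-congruence : ∀ p .{{_ : NonZero p}} x m → m < p → x ^ 3 % p ≡ m % p →
    (cube (+ x) - + m) %ℕ p ≡ 0
  cube-congruence p x m m<p x³≡m = begin
    (cube (+ x) - + m) %ℕ p      ≡⟨ cong (λ z → (z - + m) %ℕ p) (trans (cube-+ x) (cong +_ x³≡m+kp)) ⟩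
    (+ (m + k * p) - + m) %ℕ p   ≡⟨ cong (_%ℕ p) (+[m+n]-+m m (k * p)) ⟩
    (k * p) % p                  ≡⟨ m*n%n≡0 k p ⟩
    0                            ∎
    where
    open ≡-Reasoning
    k = x ^ 3 / p
    x³≡m+kp : x ^ 3 ≡ m + k * p
    x³≡m+kp =
      trans (m≡m%n+[m/n]*n (x ^ 3) p) (cong (_+ k * p) (trans x³≡m (m<n⇒m%n≡m m<p)))

  module _ {p : ℕ} (pr : Prime p) (p%3≡2 : p % 3 ≡ 2) where

    instance
      p≢0 : NonZero p
      p≢0 = prime⇒nonZero pr

    cubicSym-unit : ∀ m → 0 < m → m < p → cubicSym p (+ m) ≡ + 1
    cubicSym-unit m 0<m m<p with cube-root pr p%3≡2 m
    ... | x , x<p , x³≡m = cubicSym-cube p (+ m) m%p≢0 x x<p (cube-congruence p x m m<p x³≡m)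
      where
      m%p≢0 : ¬ m % p ≡ 0
      m%p≢0 m%p≡0 = <⇒≢ 0<m (sym (trans (sym (m<n⇒m%n≡m m<p)) m%p≡0))

    -- Row i of M_n consists of ones when i < c and n + c ≤ i + p: its arguments
    -- j - i + c (j < n) then lie strictly between 0 and p.
    row-of-ones : ∀ {n c r} (i : Fin n) → toℕ i ≡ r → r < c → n + c ≤ r + p →
      ∀ j → cubicMatrix p (+ c) n i j ≡ + 1
    row-of-ones {n} {c} {r} i refl r<c n+c≤r+p j =
      trans (cong (cubicSym p) (shift r (toℕ j) c (<⇒≤ r<j+c)))
            (cubicSym-unit (toℕ j + c ∸ r) (m<n⇒0<n∸m r<j+c)
                           (m<n+o⇒m∸n<o (toℕ j + c) r j+c<r+p))
      where
      r<j+c : r < toℕ j + c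
      r<j+c = <-≤-trans r<c (m≤n+m c (toℕ j))
      j+c<r+p : toℕ j + c < r + p
      j+c<r+p = <-≤-trans (+-monoˡ-< c (toℕ<n j)) n+c≤r+p

    adjacent-rows-of-ones : ∀ n₀ {c} → 2 ≤ c → 2 + n₀ + 2 ≤ p → c + 2 ≤ p →
      let M = cubicMatrix p (+ c) (2 + n₀) in
      ∃[ i ] (∀ x → M (suc i) x ≡ M (inject₁ i) x)
    adjacent-rows-of-ones n₀ {c@(suc (suc c₀))} (s≤s (s≤s _)) n+2≤p c+2≤p =
      i , λ x → trans (row-of-ones (suc i) (cong suc ti) (s≤s (s≤s r≤c₀)) n+c≤1+r+p x)
                      (sym (row-of-ones (inject₁ i) ti′ (s≤s (m≤n⇒m≤1+n r≤c₀)) n+c≤r+p x))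
      where
      n = 2 + n₀
      r = n + c ∸ p
      arith : ∀ a b → a + (2 + b) ≡ a + 2 + b
      arith = solve-∀
      r≤c₀ : r ≤ c₀
      r≤c₀ = m≤n+o⇒m∸n≤o (n + c) p
               (subst (_≤ p + c₀) (sym (arith n c₀)) (+-monoˡ-≤ c₀ n+2≤p))
      r≤n₀ : r ≤ n₀
      r≤n₀ = m≤n+o⇒m∸n≤o (n + c) p
               (subst (_≤ p + n₀) (trans (sym (arith c n₀)) (+-comm c n)) (+-monoˡ-≤ n₀ c+2≤p))
      n+c≤r+p : n + c ≤ r + p
      n+c≤r+p = subst (n + c ≤_) (+-comm p r) (m≤n+m∸n (n + c) p)
      n+c≤1+r+p : n + c ≤ suc r + p
      n+c≤1+r+p = ≤-trans n+c≤r+p (n≤1+n (r + p))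
      i : Fin (suc n₀)
      i = fromℕ< (s≤s r≤n₀)
      ti : toℕ i ≡ r
      ti = toℕ-fromℕ< (s≤s r≤n₀)
      ti′ : toℕ (inject₁ i) ≡ r
      ti′ = trans (toℕ-inject₁ i) ti

open import Data.Nat using (ℕ; NonZero; _≤_; _∸_; _%_; _+_; suc; s≤s; nonTrivial⇒n>1)
open import Data.Nat.Properties using (m≤o∸n⇒m+n≤o)
open import Data.Nat.Primality using (Prime; prime⇒nonTrivial)
open import Data.Integer using (ℤ; +_; +≤+) renaming (_≤_ to _≤ℤ_)
open import Data.Product using (_,_)
open import Relation.Binary.PropositionalEquality using (_≡_)
open Determinant using (det-adjacent-rows)
open CubicSymbol using (adjacent-rows-of-ones)

theorem3p7 : (p : ℕ) .{{_ : NonZero p}} → Prime p → p % 2 ≡ 1 → p % 3 ≡ 2 →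
    (c : ℤ) → + 2 ≤ℤ c → c ≤ℤ + (p ∸ 2) →
    (n : ℕ) → 2 ≤ n → n ≤ p ∸ 2 →
    det n (cubicMatrix p c n) ≡ + 0
theorem3p7 p pr _ p%3≡2 (+ c) (+≤+ 2≤c) (+≤+ c≤p∸2) n@(suc (suc n₀)) (s≤s (s≤s _)) n≤p∸2 =
  let i , rows≡ = adjacent-rows-of-ones pr p%3≡2 n₀ 2≤c n+2≤p c+2≤p
  in det-adjacent-rows n₀ (cubicMatrix p (+ c) n) i rows≡
  where
  2≤p : 2 ≤ p
  2≤p = nonTrivial⇒n>1 p {{prime⇒nonTrivial pr}}
  n+2≤p : n + 2 ≤ p
  n+2≤p = m≤o∸n⇒m+n≤o n 2≤p n≤p∸2
  c+2≤p : c + 2 ≤ p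
  c+2≤p = m≤o∸n⇒m+n≤o c 2≤p c≤p∸2
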